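{- Let $N\ge 1$, $s\ge1$, $1\le i\le s$, and let $\sigma$ be a permutation of length $\ell\le N-1-i$. Then there exists a collection $G^{\sigma,i}$ of permutations having $\sigma$ as a prefix, which can be partitioned into $\Gamma^{\sigma,i}_1,\dots,\Gamma^{\sigma,i}_i$, such that every $\mu\in G^{\sigma,i}$ has length larger than $\ell$, the set $G^{\sigma,i}$ is $i$-minimal, every $\gamma\in\Gamma^{\sigma,i}_j$ is type $j$-positive ($1\le j\le i$), and $$Q_i(\sigma)\cdot SD(\sigma)=Q_1(\sigma)\cdot SD(\sigma)+\sum_{\mu\in G^{\sigma,i-1}}Q_1(\mu)\cdot SD(\mu),$$ $$Q^o_i(\sigma)\cdot SD(\sigma)=\sum_{\gamma\in\Gamma^{\sigma,i}_i}Q_i(\gamma)\cdot SD(\gamma)=\sum_{\mu\in G^{\sigma,i}}Q_1(\mu)\cdot SD(\mu),\qquad SD(\sigma)=\sum_{\gamma\in\Gamma^{\sigma,i}_i}SD(\gamma),$$ where $G^{\sigma,i-1}$ is such a collection for $i-1$ (and $G^{\sigma,0}=\emptyset$).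
   Context: Setting: $N$ applicants labeled $1,\dots,N$ by quality ($N$ best); interview order a uniformly random $\pi\in S_N$ revealed from the left, only relative orders observed; $s$ selections, each applicant irrevocably accepted (using a selection) or rejected; win if a selected applicant has value $N$. For $\pi$ of length $\ge k$, $\pi|_k\in S_k$ is the relabelling of its first $k$ entries by relative order; $\tau$ has $\sigma\in S_k$ as a prefix if $\tau|_k=\sigma$; $\pi\in S_N$ is then $\sigma$-prefixed. $SD(\sigma)$ = number of $\sigma$-prefixed $\pi\in S_N$; $Win(\sigma)$ = number of those with $\pi(k)=N$. For $\sigma$ of length $k$, $1\le i\le s$: $Q_1(\sigma)=Win(\sigma)/SD(\sigma)$; $Q_i(\sigma)$ = probability of winning by accepting the $k$-th applicant and playing optimally afterwards, conditioned on $\pi$ $\sigma$-prefixed and $i$ selections available when interviewing applicant $k$; $Q^o_i(\sigma)$ = probability of winning with the best strategy after deciding on applicant $k$, conditioned on $\pi$ $\sigma$-prefixed and $i$ selections still available right after interviewing applicant $k$. $\sigma$ is type $j$-positive if $Q_j(\sigma)\ge Q^o_j(\sigma)$. A set $X$ of permutations is $i$-minimal if there are no $i+1$ elements $\alpha_1,\dots,\alpha_{i+1}\in X$ with $\alpha_{m+1}$ a (proper) prefix of $\alpha_m$ for all $1\le m\le i$. -}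

module Defs where

open import Data.Nat as ℕ using (ℕ; zero; suc; _+_; _∸_; _≤_; _<_; _≤?_; _<?_)
import Data.Nat.Properties as ℕP
open import Data.Integer using (+_)
open import Data.Rational using (ℚ; 0ℚ; _/_; _⊔_) renaming (_+_ to _+ℚ_; _*_ to _*ℚ_; _≤_ to _≤ℚ_)
open import Data.List using (List; []; _∷_; length; map; filter; concat; concatMap; take; applyUpTo; foldr; allFin)
open import Data.Nat.ListAction using (sum)
open import Data.List.Properties using (≡-dec)
open import Data.List.Relation.Unary.All using (All; all?)
open import Data.List.Membership.Propositional using (_∈_)
open import Data.List.Relation.Binary.Permutation.Propositional using (_↭_)
open import Data.List.Relation.Unary.Unique.DecPropositional ℕP._≟_ using (Unique; unique?)
open import Data.Maybe using (Maybe; just; nothing)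
open import Data.Maybe.Properties using () renaming (≡-dec to ≡-decM)
open import Data.Fin using (Fin; toℕ; fromℕ; inject₁) renaming (suc to fsuc)
open import Data.Product using (Σ; Σ-syntax; ∃; _×_; _,_)
open import Relation.Nullary using (¬_; Dec)
open import Relation.Nullary.Decidable using (_×-dec_)
open import Relation.Binary.PropositionalEquality using (_≡_)

IsPerm : ℕ → List ℕ → Set
IsPerm k xs = length xs ≡ k × Unique xs × All (λ x → 1 ≤ x × x ≤ k) xs

isPerm? : (k : ℕ) (xs : List ℕ) → Dec (IsPerm k xs)
isPerm? k xs = (length xs ℕP.≟ k) ×-dec (unique? xs ×-dec all? (λ x → (1 ≤? x) ×-dec (x ≤? k)) xs)

words : ℕ → ℕ → List (List ℕ)
words m zero    = [] ∷ []
words m (suc n) = concatMap (λ x → map (x ∷_) (words m n)) (applyUpTo suc m)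

Perms : ℕ → List (List ℕ)
Perms N = filter (isPerm? N) (words N N)

rank : List ℕ → ℕ → ℕ
rank xs x = suc (length (filter (_<? x) xs))

std : List ℕ → List ℕ
std xs = map (rank xs) xs

restrict : ℕ → List ℕ → List ℕ
restrict k π = std (take k π)

HasPrefix : List ℕ → List ℕ → Set
HasPrefix σ τ = length σ ≤ length τ × restrict (length σ) τ ≡ σ

ProperPrefix : List ℕ → List ℕ → Set
ProperPrefix σ τ = length σ < length τ × restrict (length σ) τ ≡ σ

-- 1-indexed entry π(k); π(0) is undefined
entry : List ℕ → ℕ → Maybe ℕ
entry []       _             = nothing
entry (x ∷ xs) zero          = nothing
entry (x ∷ xs) (suc zero)    = just x
entry (x ∷ xs) (suc (suc k)) = entry xs (suc k)

prefixed? : (σ π : List ℕ) → Dec (restrict (length σ) π ≡ σ)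
prefixed? σ π = ≡-dec ℕP._≟_ (restrict (length σ) π) σ

SD : ℕ → List ℕ → ℕ
SD N σ = length (filter (prefixed? σ) (Perms N))

Win : ℕ → List ℕ → ℕ
Win N σ = length (filter (λ π → prefixed? σ π ×-dec ≡-decM ℕP._≟_ (entry π (length σ)) (just N)) (Perms N))

-- a / b as a rational, with the convention a / 0 = 0
frac : ℕ → ℕ → ℚ
frac a zero    = 0ℚ
frac a (suc b) = (+ a) / suc b

SDq : ℕ → List ℕ → ℚ
SDq N σ = frac (SD N σ) 1

sumℚ : List ℚ → ℚ
sumℚ = foldr _+ℚ_ 0ℚ

Q1 : ℕ → List ℕ → ℚ
Q1 N σ = frac (Win N σ) (SD N σ)

ext : List ℕ → List (List ℕ)
ext σ = filter (prefixed? σ) (Perms (suc (length σ)))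

-- Optimal continuation value (backward induction / Bellman recursion).
-- QoF f N i σ, with fuel f = N ∸ length σ, is the probability of winning
-- with the best strategy after applicant k = length σ has been decided,
-- given π is σ-prefixed and i selections remain:
--   * 0 if no applicants remain (k ≥ N) or no selections remain (i = 0);
--   * otherwise, averaging over the next relative order τ (with conditional
--     probability SD(τ)/SD(σ)) of the better of accepting applicant k+1
--     (value Q_1(τ) + Q^o_{i-1}(τ)) and rejecting it (value Q^o_i(τ)).
QoF : ℕ → ℕ → ℕ → List ℕ → ℚ
QoF zero    N i       σ = 0ℚ
QoF (suc f) N zero    σ = 0ℚ
QoF (suc f) N (suc i) σ =
  sumℚ (map (λ τ → frac (SD N τ) (SD N σ) *ℚ
                   ((Q1 N τ +ℚ QoF f N i τ) ⊔ QoF f N (suc i) τ))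
            (ext σ))

Qo : ℕ → ℕ → List ℕ → ℚ
Qo N i σ = QoF (N ∸ length σ) N i σ

-- Q_i(σ) (i ≥ 1): accept applicant k (win if it is the overall best),
-- then play optimally with the remaining i-1 selections.
Q : ℕ → ℕ → List ℕ → ℚ
Q N i σ = Q1 N σ +ℚ Qo N (i ∸ 1) σ

TypePositive : ℕ → ℕ → List ℕ → Set
TypePositive N j σ = Qo N j σ ≤ℚ Q N j σ

Minimal : ℕ → List (List ℕ) → Set
Minimal i X = ¬ (Σ[ α ∈ (Fin (suc i) → List ℕ) ]
                   ((∀ m → α m ∈ X) ×
                    (∀ (m : Fin i) → ProperPrefix (α (fsuc m)) (α (inject₁ m)))))

-- Coll N σ i G (i ≥ 1): G is a set of permutations having σ as a prefix,
-- all of length > ℓ, partitioned into Γ_1..Γ_i (Γ j stands for Γ_{j+1}),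
-- i-minimal, each γ ∈ Γ_j type j-positive, and
--   Q^o_i(σ)SD(σ) = Σ_{γ∈Γ_i} Q_i(γ)SD(γ) = Σ_{μ∈G} Q_1(μ)SD(μ),
--   SD(σ) = Σ_{γ∈Γ_i} SD(γ).

Coll : ℕ → List ℕ → ℕ → List (List ℕ) → Set
Coll N σ zero     G = G ≡ []
Coll N σ (suc i') G =
  Σ[ Γ ∈ (Fin (suc i') → List (List ℕ)) ]
    ( Unique′ G
    × G ↭ concat (map Γ (allFin (suc i')))
    × All (λ μ → IsPerm (length μ) μ × HasPrefix σ μ × length σ < length μ) G
    × Minimal (suc i') G
    × (∀ (j : Fin (suc i')) → All (TypePositive N (suc (toℕ j))) (Γ j))
    × (Qo N (suc i') σ *ℚ SDq N σ
         ≡ sumℚ (map (λ γ → Q N (suc i') γ *ℚ SDq N γ) (Γ (fromℕ i'))))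
    × (Qo N (suc i') σ *ℚ SDq N σ
         ≡ sumℚ (map (λ μ → Q1 N μ *ℚ SDq N μ) G))
    × (SD N σ ≡ sum (map (SD N) (Γ (fromℕ i')))) )
  where
  open import Data.List.Relation.Unary.Unique.DecPropositional (≡-dec ℕP._≟_)
    using () renaming (Unique to Unique′)

{-# OPTIONS --safe #-}
-- The collection is read off the optimal strategy. Starting after σ with i selections, run through
-- the one-step extensions τ of the relative order seen so far; at τ, if accepting is optimal (τ is
-- type-i positive), record τ with tag i and continue below τ with i − 1 selections, otherwise
-- continue with i. G is the set of recorded τ and Γ_j those tagged j. Tags lie in 1..i and strictly
-- increase towards prefixes, so G is i-minimal. Multiplying the Bellman recursion for Q^o by SD and
-- using SD(σ) = Σ_{τ ∈ ext σ} SD(τ) (a double count of σ-prefixed permutations), the conditional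
-- probabilities cancel. Unfolding it completely, each recorded τ contributes Q_1(τ)SD(τ); stopping
-- at the first acceptance gives the Γ_i identities, which terminates because an applicant after whom
-- nobody is left is always accepted. Finally Q_i = Q_1 + Q^o_{i−1} turns the identity for Q^o_{i−1}
-- into the one for Q_i.

module Submission where

open import Defs
open import Data.Nat using (ℕ; _+_; _∸_; _≤_)
open import Data.List using (List; length; map)
open import Data.Product using (Σ-syntax; _×_)
open import Data.Rational using (ℚ) renaming (_+_ to _+ℚ_; _*_ to _*ℚ_)
open import Relation.Binary.PropositionalEquality using (_≡_)

open import Algebra.Bundles using (CommutativeSemigroup)
open import Algebra.Core using (Op₂)
open import Algebra.Structures using (IsCommutativeMonoid)
import Algebra.Properties.CommutativeSemigroup as CommutativeSemigroupProperties
open import Data.Empty using (⊥-elim)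
open import Data.Fin using (Fin; toℕ; fromℕ; fromℕ<; inject₁) renaming (suc to fsuc)
import Data.Fin.Properties as FinP
import Data.Integer as ℤ
import Data.Integer.Properties as ℤP
open import Data.List using ([]; _∷_; _++_; filter; take; concat; concatMap; applyUpTo; allFin; foldr)
import Data.List.Properties as LP
open import Data.List.Membership.Propositional using (_∈_; _∉_; find; lose)
open import Data.List.Membership.Propositional.Properties
  using (∈-map⁻; ∈-map⁺; ∈-concat⁺′; ∈-applyUpTo⁺; ∈-filter⁻; ∈-filter⁺; ∈-concatMap⁻; ∈-allFin)
open import Data.List.Relation.Binary.Permutation.Propositional using (_↭_; ↭-trans; ↭-sym; ↭-reflexive; prep)
import Data.List.Relation.Binary.Permutation.Propositional.Properties as ↭P
open import Data.List.Relation.Binary.Sublist.Propositional using (⊆-refl)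
open import Data.List.Relation.Binary.Sublist.Propositional.Properties
  using (filter⁺; length-mono-≤; take-⊆; Any-resp-⊆)
open import Data.List.Relation.Unary.All as All using (All; []; _∷_)
import Data.List.Relation.Unary.All.Properties as AllP
open import Data.List.Relation.Unary.AllPairs using ([]; _∷_)
open import Data.List.Relation.Unary.Any using (here; there)
open import Data.List.Relation.Unary.Unique.Propositional using (Unique)
import Data.List.Relation.Unary.Unique.Propositional.Properties as UniqueP
open import Data.Nat as ℕ using (zero; suc; _<_; _<?_; s≤s; z≤n; _⊓_)
open import Data.Nat.ListAction using (sum)
import Data.Nat.Properties as ℕP
open import Data.Product using (_,_; proj₁; proj₂; ∃)
open import Data.Rational using (0ℚ; toℚᵘ; _⊔_) renaming (_≤_ to _≤ℚ_)
import Data.Rational.Properties as ℚP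
import Data.Rational.Unnormalised as ℚᵘ
import Data.Rational.Unnormalised.Properties as ℚᵘP
open import Data.Sum using (_⊎_; inj₁; inj₂)
open import Function using (_∘_)
open import Level using (0ℓ)
open import Relation.Binary.Definitions using (tri<; tri≈; tri>)
open import Relation.Binary.PropositionalEquality
  using (refl; sym; trans; cong; cong₂; subst; subst₂; _≢_; module ≡-Reasoning)
open import Relation.Nullary using (yes; no; Dec; ¬_)
open import Relation.Unary using (Pred; Decidable)

-- Sums and counting over lists

module ListSum {A : Set} {_∙_ : Op₂ A} {ε : A} (isCM : IsCommutativeMonoid _≡_ _∙_ ε) where
  open IsCommutativeMonoid isCM using (identityˡ; assoc; isCommutativeSemigroup)

  private
    commutativeSemigroup : CommutativeSemigroup 0ℓ 0ℓ
    commutativeSemigroup = record { isCommutativeSemigroup = isCommutativeSemigroup }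

  open CommutativeSemigroupProperties commutativeSemigroup using (interchange)
  open ≡-Reasoning

  ∑ : List A → A
  ∑ = foldr _∙_ ε

  ∑-++ : ∀ xs ys → ∑ (xs ++ ys) ≡ ∑ xs ∙ ∑ ys
  ∑-++ []       ys = sym (identityˡ (∑ ys))
  ∑-++ (x ∷ xs) ys = trans (cong (x ∙_) (∑-++ xs ys)) (sym (assoc x (∑ xs) (∑ ys)))

  ∑-map-cong : {B : Set} {f g : B → A} (xs : List B) → (∀ {x} → x ∈ xs → f x ≡ g x) →
               ∑ (map f xs) ≡ ∑ (map g xs)
  ∑-map-cong xs f≗g = cong ∑ (LP.map-cong-local (All.tabulate f≗g))

  ∑-map-const-ε : {B : Set} (xs : List B) → ∑ (map (λ _ → ε) xs) ≡ ε
  ∑-map-const-ε []       = refl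
  ∑-map-const-ε (x ∷ xs) = trans (cong (ε ∙_) (∑-map-const-ε xs)) (identityˡ ε)

  ∑-map-∙ : {B : Set} (f g : B → A) (xs : List B) →
            ∑ (map (λ x → f x ∙ g x) xs) ≡ ∑ (map f xs) ∙ ∑ (map g xs)
  ∑-map-∙ f g []       = sym (identityˡ ε)
  ∑-map-∙ f g (x ∷ xs) =
    trans (cong ((f x ∙ g x) ∙_) (∑-map-∙ f g xs)) (interchange (f x) (g x) _ _)

  ∑-map-concatMap : {B C : Set} (g : C → A) (h : B → List C) (xs : List B) →
                    ∑ (map g (concatMap h xs)) ≡ ∑ (map (λ x → ∑ (map g (h x))) xs)
  ∑-map-concatMap g h []       = refl
  ∑-map-concatMap g h (x ∷ xs) = begin
    ∑ (map g (h x ++ concatMap h xs))               ≡⟨ cong ∑ (LP.map-++ g (h x) _) ⟩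
    ∑ (map g (h x) ++ map g (concatMap h xs))       ≡⟨ ∑-++ (map g (h x)) _ ⟩
    ∑ (map g (h x)) ∙ ∑ (map g (concatMap h xs))   ≡⟨ cong (_ ∙_) (∑-map-concatMap g h xs) ⟩
    ∑ (map g (h x)) ∙ ∑ (map (λ y → ∑ (map g (h y))) xs) ∎

  ∑-swap : {B C : Set} (F : B → C → A) (xs : List B) (ys : List C) →
           ∑ (map (λ x → ∑ (map (F x) ys)) xs) ≡ ∑ (map (λ y → ∑ (map (λ x → F x y) xs)) ys)
  ∑-swap F []       ys = sym (∑-map-const-ε ys)
  ∑-swap F (x ∷ xs) ys = trans (cong (∑ (map (F x) ys) ∙_) (∑-swap F xs ys))
                               (sym (∑-map-∙ (F x) (λ y → ∑ (map (λ x′ → F x′ y) xs)) ys))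

open ListSum ℕP.+-0-isCommutativeMonoid using ()
  renaming (∑-map-cong to sum-map-cong; ∑-map-concatMap to sum-map-concatMap; ∑-swap to sum-swap)
open ListSum ℚP.+-0-isCommutativeMonoid using ()
  renaming (∑-map-cong to sumℚ-map-cong; ∑-map-concatMap to sumℚ-map-concatMap)

sum-map-≤ : {A : Set} (f : A → ℕ) {x : A} {xs : List A} → x ∈ xs → f x ≤ sum (map f xs)
sum-map-≤ f {xs = y ∷ xs} (here refl) = ℕP.m≤m+n (f y) _
sum-map-≤ f {xs = y ∷ xs} (there x∈) = ℕP.≤-trans (sum-map-≤ f x∈) (ℕP.m≤n+m _ (f y))

sumℚ-map-*ʳ : {A : Set} (f : A → ℚ) (c : ℚ) (xs : List A) →
              sumℚ (map f xs) *ℚ c ≡ sumℚ (map (λ x → f x *ℚ c) xs)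
sumℚ-map-*ʳ f c []       = ℚP.*-zeroˡ c
sumℚ-map-*ʳ f c (x ∷ xs) = trans (ℚP.*-distribʳ-+ c (f x) _) (cong (f x *ℚ c +ℚ_) (sumℚ-map-*ʳ f c xs))

indicator : {P : Set} → Dec P → ℕ
indicator (yes _) = 1
indicator (no  _) = 0

module _ {A : Set} {P : Pred A 0ℓ} (P? : Decidable P) where

  length-filter≡sum-indicator : (xs : List A) → length (filter P? xs) ≡ sum (map (indicator ∘ P?) xs)
  length-filter≡sum-indicator []       = refl
  length-filter≡sum-indicator (x ∷ xs) with P? x
  ... | yes _ = cong suc (length-filter≡sum-indicator xs)
  ... | no  _ = length-filter≡sum-indicator xs

  length-filter-none : {xs : List A} → (∀ {y} → y ∈ xs → ¬ P y) → length (filter P? xs) ≡ 0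
  length-filter-none ¬P = cong length (LP.filter-none P? (All.tabulate ¬P))

  length-filter-unique : {x : A} {xs : List A} → Unique xs → x ∈ xs → P x →
                         (∀ {y} → y ∈ xs → P y → y ≡ x) → length (filter P? xs) ≡ 1
  length-filter-unique {xs = y ∷ xs} (y∉ ∷ _) (here refl) px only with P? y
  ... | yes _  = cong suc (length-filter-none (λ z∈ pz → All.lookup y∉ z∈ (sym (only (there z∈) pz))))
  ... | no ¬py = ⊥-elim (¬py px)
  length-filter-unique {xs = y ∷ xs} (y∉ ∷ u) (there x∈) px only with P? y
  ... | yes py = ⊥-elim (All.lookup y∉ x∈ (only (here refl) py))
  ... | no  _  = length-filter-unique u x∈ px (λ z∈ → only (there z∈))

Unique-concatMap : {A B : Set} (f : A → List B) {xs : List A} → Unique xs →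
  (∀ {x} → x ∈ xs → Unique (f x)) →
  (∀ {x x′ b} → x ∈ xs → x′ ∈ xs → b ∈ f x → b ∈ f x′ → x ≡ x′) →
  Unique (concatMap f xs)
Unique-concatMap f {[]}     []        _      _        = []
Unique-concatMap f {x ∷ xs} (x∉ ∷ u) unique disjoint =
  UniqueP.++⁺ (unique (here refl))
              (Unique-concatMap f u (λ x∈ → unique (there x∈)) (λ p q → disjoint (there p) (there q)))
              (λ (b∈fx , b∈rest) → let y , y∈ , b∈fy = find (∈-concatMap⁻ f b∈rest)
                                   in All.lookup x∉ y∈ (disjoint (here refl) (there y∈) b∈fx b∈fy))

-- Relative order

rank-∷-< : ∀ K {z x} → z < x → rank (z ∷ K) x ≡ suc (rank K x)
rank-∷-< K {x = x} z<x = cong (suc ∘ length) (LP.filter-accept (_<? x) z<x)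

rank-∷-≮ : ∀ K {z x} → ¬ z < x → rank (z ∷ K) x ≡ rank K x
rank-∷-≮ K {x = x} z≮x = cong (suc ∘ length) (LP.filter-reject (_<? x) z≮x)

rank-mono : ∀ K {x y} → x ≤ y → rank K x ≤ rank K y
rank-mono K x≤y =
  s≤s (length-mono-≤ (filter⁺ (_<? _) (_<? _) (λ { refl z<x → ℕP.<-≤-trans z<x x≤y }) (⊆-refl {x = K})))

rank-strict : ∀ K {x y} → y < x → y ∈ K → rank K y < rank K x
rank-strict (y ∷ K) {x} y<x (here refl) =
  subst₂ _<_ (sym (rank-∷-≮ K (ℕP.<-irrefl refl))) (sym (rank-∷-< K y<x)) (s≤s (rank-mono K (ℕP.<⇒≤ y<x)))
rank-strict (z ∷ K) {x} {y} y<x (there y∈) with z <? y | z <? x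
... | yes z<y | yes z<x = subst₂ _<_ (sym (rank-∷-< K z<y)) (sym (rank-∷-< K z<x)) (s≤s (rank-strict K y<x y∈))
... | yes z<y | no  z≮x = ⊥-elim (z≮x (ℕP.<-trans z<y y<x))
... | no  z≮y | yes z<x = subst₂ _<_ (sym (rank-∷-≮ K z≮y)) (sym (rank-∷-< K z<x)) (ℕP.m≤n⇒m≤1+n (rank-strict K y<x y∈))
... | no  z≮y | no  z≮x = subst₂ _<_ (sym (rank-∷-≮ K z≮y)) (sym (rank-∷-≮ K z≮x)) (rank-strict K y<x y∈)

rank-≤-length : ∀ K {x} → x ∈ K → rank K x ≤ length K
rank-≤-length K {x} x∈ = LP.filter-notAll (_<? x) K (lose x∈ (ℕP.<-irrefl refl))

rank-injective : ∀ K {x y} → x ∈ K → y ∈ K → rank K x ≡ rank K y → x ≡ y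
rank-injective K {x} {y} x∈ y∈ eq with ℕP.<-cmp x y
... | tri< x<y _ _ = ⊥-elim (ℕP.<-irrefl eq (rank-strict K x<y x∈))
... | tri≈ _ x≡y _ = x≡y
... | tri> _ _ y<x = ⊥-elim (ℕP.<-irrefl (sym eq) (rank-strict K y<x y∈))

StrictlyMonotoneOn : List ℕ → (ℕ → ℕ) → Set
StrictlyMonotoneOn K f = ∀ {x y} → x ∈ K → y ∈ K → y < x → f y < f x

rank-map : ∀ K {f} → StrictlyMonotoneOn K f → ∀ {x} → x ∈ K → rank (map f K) (f x) ≡ rank K x
rank-map K {f} mono {x} x∈ = preserved K (λ y∈ → y∈)
  where
  reflects : ∀ {y} → y ∈ K → f y < f x → y < x
  reflects {y} y∈ fy<fx with ℕP.<-cmp y x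
  ... | tri< y<x _ _ = y<x
  ... | tri≈ _ refl _ = ⊥-elim (ℕP.<-irrefl refl fy<fx)
  ... | tri> _ _ x<y = ⊥-elim (ℕP.<-asym fy<fx (mono y∈ x∈ x<y))

  preserved : ∀ L → (∀ {y} → y ∈ L → y ∈ K) → rank (map f L) (f x) ≡ rank L x
  preserved []      _   = refl
  preserved (y ∷ L) L⊆K with f y <? f x | y <? x
  ... | yes fy<fx | yes y<x = trans (rank-∷-< (map f L) fy<fx)
                                    (trans (cong suc (preserved L (L⊆K ∘ there))) (sym (rank-∷-< L y<x)))
  ... | yes fy<fx | no  y≮x = ⊥-elim (y≮x (reflects (L⊆K (here refl)) fy<fx))
  ... | no  fy≮fx | yes y<x = ⊥-elim (fy≮fx (mono x∈ (L⊆K (here refl)) y<x))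
  ... | no  fy≮fx | no  y≮x = trans (rank-∷-≮ (map f L) fy≮fx)
                                    (trans (preserved L (L⊆K ∘ there)) (sym (rank-∷-≮ L y≮x)))

std-map : ∀ K {f} → StrictlyMonotoneOn K f → std (map f K) ≡ std K
std-map K {f} mono = trans (sym (LP.map-∘ K)) (LP.map-cong-local (All.tabulate (rank-map K mono)))

std-isPerm : ∀ K → Unique K → IsPerm (length K) (std K)
std-isPerm K unique = LP.length-map (rank K) K , distinct K unique (λ x∈ → x∈) , bounds
  where
  distinct : ∀ L → Unique L → (∀ {y} → y ∈ L → y ∈ K) → Unique (map (rank K) L)
  distinct []      []        _   = []
  distinct (y ∷ L) (y∉ ∷ u) L⊆K =
    AllP.map⁺ (All.tabulate (λ z∈ eq → All.lookup y∉ z∈ (rank-injective K (L⊆K (here refl)) (L⊆K (there z∈)) eq)))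
    ∷ distinct L u (L⊆K ∘ there)

  bounds : All (λ r → 1 ≤ r × r ≤ length K) (std K)
  bounds = AllP.map⁺ (All.tabulate (λ x∈ → s≤s z≤n , rank-≤-length K x∈))

restrict-restrict : ∀ {a b} μ → a ≤ b → restrict a (restrict b μ) ≡ restrict a μ
restrict-restrict {a} {b} μ a≤b = begin
  std (take a (map (rank Lb) Lb))   ≡⟨ cong std (LP.take-map a Lb) ⟩
  std (map (rank Lb) (take a Lb))   ≡⟨ std-map (take a Lb) (λ _ y∈ y<x → rank-strict Lb y<x (Any-resp-⊆ (take-⊆ a Lb) y∈)) ⟩
  std (take a Lb)                   ≡⟨ cong std (LP.take-take a b μ) ⟩
  std (take (a ⊓ b) μ)              ≡⟨ cong (λ k → std (take k μ)) (ℕP.m≤n⇒m⊓n≡m a≤b) ⟩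
  std (take a μ)                    ∎
  where
  open ≡-Reasoning
  Lb = take b μ

HasPrefix-trans : ∀ {σ τ μ} → HasPrefix σ τ → HasPrefix τ μ → HasPrefix σ μ
HasPrefix-trans {σ} {τ} {μ} (σ≤τ , rσ) (τ≤μ , rτ) =
  ℕP.≤-trans σ≤τ τ≤μ ,
  trans (sym (restrict-restrict μ σ≤τ)) (trans (cong (restrict (length σ)) rτ) rσ)

prefix-unique : ∀ {τ τ′ μ} → HasPrefix τ μ → HasPrefix τ′ μ → length τ ≡ length τ′ → τ ≡ τ′
prefix-unique {μ = μ} (_ , r) (_ , r′) eq = trans (sym r) (trans (cong (λ n → restrict n μ) eq) r′)

restrict-isPerm : ∀ {k} π → Unique π → k ≤ length π → IsPerm k (restrict k π)
restrict-isPerm {k} π unique k≤ =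
  subst (λ n → IsPerm n (restrict k π)) length-take (std-isPerm (take k π) (UniqueP.take⁺ k unique))
  where
  length-take : length (take k π) ≡ k
  length-take = trans (LP.length-take k π) (ℕP.m≤n⇒m⊓n≡m k≤)

-- Permutations, prefixes and one-step extensions

words-complete : ∀ m n xs → length xs ≡ n → All (λ x → 1 ≤ x × x ≤ m) xs → xs ∈ words m n
words-complete m zero    []       refl []                = here refl
words-complete m (suc n) (suc x ∷ xs) refl ((_ , x≤m) ∷ bs) =
  ∈-concat⁺′ (∈-map⁺ (suc x ∷_) (words-complete m n xs refl bs))
             (∈-map⁺ (λ y → map (y ∷_) (words m n)) (∈-applyUpTo⁺ suc x≤m))

words-unique : ∀ m n → Unique (words m n)
words-unique m zero    = [] ∷ []
words-unique m (suc n) =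
  Unique-concatMap (λ x → map (x ∷_) (words m n))
    (UniqueP.applyUpTo⁺₁ suc m (λ i<j _ eq → ℕP.<-irrefl (ℕP.suc-injective eq) i<j))
    (λ _ → UniqueP.map⁺ LP.∷-injectiveʳ (words-unique m n))
    same-head
  where
  same-head : ∀ {x x′ w} → x ∈ applyUpTo suc m → x′ ∈ applyUpTo suc m →
              w ∈ map (x ∷_) (words m n) → w ∈ map (x′ ∷_) (words m n) → x ≡ x′
  same-head _ _ w∈ w∈′ with ∈-map⁻ _ w∈ | ∈-map⁻ _ w∈′
  ... | _ , _ , refl | _ , _ , eq = LP.∷-injectiveˡ eq

Perms-unique : ∀ n → Unique (Perms n)
Perms-unique n = UniqueP.filter⁺ (isPerm? n) {words n n} (words-unique n n)

∈-Perms⁻ : ∀ {n π} → π ∈ Perms n → IsPerm n π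
∈-Perms⁻ {n} π∈ = proj₂ (∈-filter⁻ (isPerm? n) {xs = words n n} π∈)

∈-Perms⁺ : ∀ {n π} → IsPerm n π → π ∈ Perms n
∈-Perms⁺ {n} {π} p@(len , _ , bounds) = ∈-filter⁺ (isPerm? n) {xs = words n n} (words-complete n n π len bounds) p

ext-unique : ∀ σ → Unique (ext σ)
ext-unique σ = UniqueP.filter⁺ (prefixed? σ) {Perms (suc (length σ))} (Perms-unique (suc (length σ)))

∈-ext⁺ : ∀ {σ τ} → IsPerm (suc (length σ)) τ → restrict (length σ) τ ≡ σ → τ ∈ ext σ
∈-ext⁺ {σ} p r = ∈-filter⁺ (prefixed? σ) {xs = Perms (suc (length σ))} (∈-Perms⁺ p) r

module _ {σ τ : List ℕ} (τ∈ : τ ∈ ext σ) where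

  private
    τ-facts = ∈-filter⁻ (prefixed? σ) {xs = Perms (suc (length σ))} τ∈

  ext-length : length τ ≡ suc (length σ)
  ext-length = proj₁ (∈-Perms⁻ (proj₁ τ-facts))

  ext-isPerm : IsPerm (length τ) τ
  ext-isPerm = subst (λ n → IsPerm n τ) (sym ext-length) (∈-Perms⁻ (proj₁ τ-facts))

  ext-restrict : restrict (length σ) τ ≡ σ
  ext-restrict = proj₂ τ-facts

  ext-HasPrefix : HasPrefix σ τ
  ext-HasPrefix = subst (length σ ≤_) (sym ext-length) (ℕP.n≤1+n _) , ext-restrict

  ext-prefixed : ∀ {π} → restrict (length τ) π ≡ τ → restrict (length σ) π ≡ σ
  ext-prefixed {π} r = begin
    restrict (length σ) π                              ≡⟨ restrict-restrict π (ℕP.n≤1+n _) ⟨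
    restrict (length σ) (restrict (suc (length σ)) π) ≡⟨ cong (λ n → restrict (length σ) (restrict n π)) ext-length ⟨
    restrict (length σ) (restrict (length τ) π)       ≡⟨ cong (restrict (length σ)) r ⟩
    restrict (length σ) τ                              ≡⟨ ext-restrict ⟩
    σ                                                  ∎
    where open ≡-Reasoning

module _ (N : ℕ) (σ : List ℕ) (ℓ<N : length σ < N) where

  private
    ℓ = length σ

  ext-prefixes-count : ∀ {π} → π ∈ Perms N →
    length (filter (λ τ → prefixed? τ π) (ext σ)) ≡ indicator (prefixed? σ π)
  ext-prefixes-count {π} π∈ with prefixed? σ π
  ... | yes σ≺π = length-filter-unique (λ τ → prefixed? τ π) (ext-unique σ) τ₀∈ τ₀≺π τ₀-only
    where
    π-isPerm : IsPerm N π
    π-isPerm = ∈-Perms⁻ π∈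
    τ₀ = restrict (suc ℓ) π
    τ₀-isPerm : IsPerm (suc ℓ) τ₀
    τ₀-isPerm = restrict-isPerm π (proj₁ (proj₂ π-isPerm)) (subst (suc ℓ ≤_) (sym (proj₁ π-isPerm)) ℓ<N)
    τ₀∈ : τ₀ ∈ ext σ
    τ₀∈ = ∈-ext⁺ τ₀-isPerm (trans (restrict-restrict π (ℕP.n≤1+n ℓ)) σ≺π)
    τ₀≺π : restrict (length τ₀) π ≡ τ₀
    τ₀≺π = cong (λ n → restrict n π) (proj₁ τ₀-isPerm)
    τ₀-only : ∀ {τ} → τ ∈ ext σ → restrict (length τ) π ≡ τ → τ ≡ τ₀
    τ₀-only τ∈ τ≺π = trans (sym τ≺π) (cong (λ n → restrict n π) (ext-length {σ} τ∈))
  ... | no σ⊀π = length-filter-none (λ τ → prefixed? τ π) {ext σ} (λ τ∈ τ≺π → σ⊀π (ext-prefixed {σ} τ∈ τ≺π))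

  SD-ext : SD N σ ≡ sum (map (SD N) (ext σ))
  SD-ext = sym (begin
    sum (map (SD N) (ext σ))
      ≡⟨ sum-map-cong (ext σ) (λ {τ} _ → length-filter≡sum-indicator (prefixed? τ) (Perms N)) ⟩
    sum (map (λ τ → sum (map (λ π → indicator (prefixed? τ π)) (Perms N))) (ext σ))
      ≡⟨ sum-swap (λ τ π → indicator (prefixed? τ π)) (ext σ) (Perms N) ⟩
    sum (map (λ π → sum (map (λ τ → indicator (prefixed? τ π)) (ext σ))) (Perms N))
      ≡⟨ sum-map-cong (Perms N) (λ {π} π∈ →
           trans (sym (length-filter≡sum-indicator (λ τ → prefixed? τ π) (ext σ))) (ext-prefixes-count π∈)) ⟩
    sum (map (λ π → indicator (prefixed? σ π)) (Perms N))
      ≡⟨ length-filter≡sum-indicator (prefixed? σ) (Perms N) ⟨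
    SD N σ ∎)
    where open ≡-Reasoning

SD-ext-≤ : ∀ N {σ τ} → length σ < N → τ ∈ ext σ → SD N τ ≤ SD N σ
SD-ext-≤ N {σ} ℓ<N τ∈ = subst (SD N _ ≤_) (sym (SD-ext N σ ℓ<N)) (sum-map-≤ (SD N) τ∈)

-- Tagged lists

module _ {A : Set} where

  level : ℕ → List (A × ℕ) → List A
  level k L = map proj₁ (filter (λ x → proj₂ x ℕ.≟ k) L)

  level-∷-≡ : ∀ {a j} L → level j ((a , j) ∷ L) ≡ a ∷ level j L
  level-∷-≡ {j = j} L = cong (map proj₁) (LP.filter-accept (λ x → proj₂ x ℕ.≟ j) refl)

  level-∷-≢ : ∀ {a j k} L → j ≢ k → level k ((a , j) ∷ L) ≡ level k L
  level-∷-≢ {k = k} L j≢k = cong (map proj₁) (LP.filter-reject (λ x → proj₂ x ℕ.≟ k) j≢k)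

  level-++ : ∀ k L L′ → level k (L ++ L′) ≡ level k L ++ level k L′
  level-++ k L L′ = trans (cong (map proj₁) (LP.filter-++ (λ x → proj₂ x ℕ.≟ k) L L′))
                          (LP.map-++ proj₁ (filter (λ x → proj₂ x ℕ.≟ k) L) _)

  level-concatMap : ∀ {B : Set} k (f : B → List (A × ℕ)) xs →
                    level k (concatMap f xs) ≡ concatMap (level k ∘ f) xs
  level-concatMap k f []       = refl
  level-concatMap k f (x ∷ xs) = trans (level-++ k (f x) _) (cong (level k (f x) ++_) (level-concatMap k f xs))

  level-above : ∀ k L → (∀ {x} → x ∈ L → proj₂ x < k) → level k L ≡ []
  level-above k []            _    = refl
  level-above k ((a , j) ∷ L) tags<k =
    trans (level-∷-≢ L (λ j≡k → ℕP.<-irrefl j≡k (tags<k (here refl)))) (level-above k L (tags<k ∘ there))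

  ∈-level⁻ : ∀ {a k} L → a ∈ level k L → (a , k) ∈ L
  ∈-level⁻ {k = k} L a∈ with ∈-map⁻ proj₁ a∈
  ... | _ , x∈ , refl with ∈-filter⁻ (λ x → proj₂ x ℕ.≟ k) {xs = L} x∈
  ... | x∈L , refl = x∈L

  ∈-map-proj₁⁻ : ∀ {a} (L : List (A × ℕ)) → a ∈ map proj₁ L → ∃ λ j → (a , j) ∈ L
  ∈-map-proj₁⁻ L a∈ with ∈-map⁻ proj₁ a∈
  ... | (_ , j) , x∈ , refl = j , x∈

  levels : List ℕ → List (A × ℕ) → List A
  levels ks L = concat (map (λ k → level k L) ks)

  private
    levels-[] : ∀ ks → levels ks [] ≡ []
    levels-[] []       = refl
    levels-[] (k ∷ ks) = levels-[] ks

    levels-∉ : ∀ {a j} ks L → j ∉ ks → levels ks ((a , j) ∷ L) ≡ levels ks L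
    levels-∉ []       L _   = refl
    levels-∉ (k ∷ ks) L j∉ =
      cong₂ _++_ (level-∷-≢ L (λ j≡k → j∉ (here j≡k))) (levels-∉ ks L (j∉ ∘ there))

    levels-∈ : ∀ {a j} ks L → Unique ks → j ∈ ks → levels ks ((a , j) ∷ L) ↭ a ∷ levels ks L
    levels-∈ (k ∷ ks) L (k∉ ∷ _) (here refl) =
      ↭-reflexive (cong₂ _++_ (level-∷-≡ L) (levels-∉ ks L (λ k∈ → All.lookup k∉ k∈ refl)))
    levels-∈ {a} (k ∷ ks) L (k∉ ∷ u) (there j∈) =
      ↭-trans (↭-reflexive (cong (_++ _) (level-∷-≢ L (λ j≡k → All.lookup k∉ j∈ (sym j≡k)))))
              (↭-trans (↭P.++⁺ˡ (level k L) (levels-∈ ks L u j∈)) (↭P.shift a (level k L) _))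

  map-proj₁-↭-levels : ∀ ks L → Unique ks → (∀ {x} → x ∈ L → proj₂ x ∈ ks) → map proj₁ L ↭ levels ks L
  map-proj₁-↭-levels ks []       _ _       = ↭-reflexive (sym (levels-[] ks))
  map-proj₁-↭-levels ks (x ∷ L) u tags∈ks =
    ↭-trans (prep (proj₁ x) (map-proj₁-↭-levels ks L u (tags∈ks ∘ there)))
            (↭-sym (levels-∈ ks L u (tags∈ks (here refl))))

  levels-partition : ∀ n (L : List (A × ℕ)) → (∀ {x} → x ∈ L → 1 ≤ proj₂ x × proj₂ x ≤ n) →
                     map proj₁ L ↭ concat (map (λ j → level (suc (toℕ j)) L) (allFin n))
  levels-partition n L tags =
    ↭-trans (map-proj₁-↭-levels keys L keys-unique (key-∈ ∘ tags))
            (↭-reflexive (cong concat (sym (LP.map-∘ (allFin n)))))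
    where
    keys : List ℕ
    keys = map (suc ∘ toℕ) (allFin n)

    keys-unique : Unique keys
    keys-unique = UniqueP.map⁺ (FinP.toℕ-injective ∘ ℕP.suc-injective) (UniqueP.allFin⁺ n)

    key-∈ : ∀ {j} → 1 ≤ j × j ≤ n → j ∈ keys
    key-∈ {suc j} (_ , j<n) =
      subst (_∈ keys) (cong suc (FinP.toℕ-fromℕ< j<n)) (∈-map⁺ (suc ∘ toℕ) (∈-allFin (fromℕ< j<n)))

Minimal-by-tags : ∀ i (L : List (List ℕ × ℕ)) →
  (∀ {μ j} → (μ , j) ∈ L → 1 ≤ j × j ≤ i) →
  (∀ {μ j μ′ j′} → (μ , j) ∈ L → (μ′ , j′) ∈ L → ProperPrefix μ′ μ → j < j′) →
  Minimal i (map proj₁ L)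
Minimal-by-tags i L bounds increasing (α , α∈ , chain) =
  let _ , x∈ = ∈-map-proj₁⁻ L (α∈ (fromℕ i))
  in ℕP.<⇒≱ (tag-bound i α α∈ chain x∈) (proj₂ (bounds x∈))
  where
  tag-bound : ∀ n (β : Fin (suc n) → List ℕ) → (∀ m → β m ∈ map proj₁ L) →
              (∀ (m : Fin n) → ProperPrefix (β (fsuc m)) (β (inject₁ m))) →
              ∀ {j} → (β (fromℕ n) , j) ∈ L → suc n ≤ j
  tag-bound zero    β _  _     x∈ = proj₁ (bounds x∈)
  tag-bound (suc n) β β∈ chain x∈ =
    let _ , x′∈ = ∈-map-proj₁⁻ L (β∈ (inject₁ (fromℕ n)))
    in ℕP.≤-trans (s≤s (tag-bound n (β ∘ inject₁) (β∈ ∘ inject₁) (chain ∘ inject₁) x′∈))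
                  (increasing x′∈ x∈ (chain (fromℕ n)))

-- The optimal strategy

frac-*-denominator : ∀ a b → (b ≡ 0 → a ≡ 0) → frac a b *ℚ frac b 1 ≡ frac a 1
frac-*-denominator a zero    b≡0⇒a≡0 rewrite b≡0⇒a≡0 refl = ℚP.*-zeroˡ (frac 0 1)
frac-*-denominator a (suc b) _ = ℚP.toℚᵘ-injective (begin
  toℚᵘ (frac a (suc b) *ℚ frac (suc b) 1)          ≈⟨ ℚP.toℚᵘ-homo-* (frac a (suc b)) (frac (suc b) 1) ⟩
  toℚᵘ (frac a (suc b)) ℚᵘ.* toℚᵘ (frac (suc b) 1) ≈⟨ ℚᵘP.*-cong (ℚP.toℚᵘ-fromℚᵘ a/sb) (ℚP.toℚᵘ-fromℚᵘ sb/1) ⟩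
  a/sb ℚᵘ.* sb/1                                    ≈⟨ ℚᵘ.*≡* cross-multiplied ⟩
  ℚᵘ.mkℚᵘ (ℤ.+ a) 0                                 ≈⟨ ℚP.toℚᵘ-fromℚᵘ (ℚᵘ.mkℚᵘ (ℤ.+ a) 0) ⟨
  toℚᵘ (frac a 1)                                   ∎)
  where
  open ℚᵘP.≃-Reasoning
  a/sb sb/1 : ℚᵘ.ℚᵘ
  a/sb = ℚᵘ.mkℚᵘ (ℤ.+ a) b
  sb/1 = ℚᵘ.mkℚᵘ (ℤ.+ suc b) 0
  cross-multiplied : (ℤ.+ a ℤ.* ℤ.+ suc b) ℤ.* ℤ.+ 1 ≡ ℤ.+ a ℤ.* ℤ.+ (suc b ℕ.* 1)
  cross-multiplied = trans (ℤP.*-identityʳ _) (cong (λ n → ℤ.+ a ℤ.* ℤ.+ n) (sym (ℕP.*-identityʳ (suc b))))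

0≤frac : ∀ a b → 0ℚ ≤ℚ frac a b
0≤frac a zero    = ℚP.≤-refl
0≤frac a (suc b) = ℚP.nonNegative⁻¹ _ {{ℚP.normalize-nonNeg a (suc b)}}

-- Not expressed via HasPrefix: HasPrefix τ τ amounts to std τ ≡ τ, a fact about permutations
-- that the development avoids.
_⊑_ : List ℕ → List ℕ → Set
τ ⊑ μ = τ ≡ μ ⊎ ProperPrefix τ μ

⊑-unique : ∀ {τ τ′ μ} → τ ⊑ μ → τ′ ⊑ μ → length τ ≡ length τ′ → τ ≡ τ′
⊑-unique (inj₁ refl) (inj₁ refl) _ = refl
⊑-unique (inj₁ refl) (inj₂ (lt , _)) eq = ⊥-elim (ℕP.<-irrefl (sym eq) lt)
⊑-unique (inj₂ (lt , _)) (inj₁ refl) eq = ⊥-elim (ℕP.<-irrefl eq lt)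
⊑-unique (inj₂ (lt , r)) (inj₂ (lt′ , r′)) eq = prefix-unique (ℕP.<⇒≤ lt , r) (ℕP.<⇒≤ lt′ , r′) eq

⊑-⊏ : ∀ {τ μ′ μ} → τ ⊑ μ′ → ProperPrefix μ′ μ → τ ⊑ μ
⊑-⊏ (inj₁ refl)    μ′⊏μ = inj₂ μ′⊏μ
⊑-⊏ (inj₂ (lt , r)) (lt′ , r′) =
  inj₂ (ℕP.<-trans lt lt′ , proj₂ (HasPrefix-trans (ℕP.<⇒≤ lt , r) (ℕP.<⇒≤ lt′ , r′)))

Q1·SD : ℕ → List ℕ → ℚ
Q1·SD N μ = Q1 N μ *ℚ SDq N μ

Q·SD : ℕ → ℕ → List ℕ → ℚ
Q·SD N i γ = Q N i γ *ℚ SDq N γ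

module StoppingRule (N : ℕ) where

  positive? : ∀ j τ → Dec (TypePositive N j τ)
  positive? j τ = Qo N j τ ℚP.≤? Q N j τ

  -- (μ , j) ∈ stops f i σ: after σ, with i selections and f applicants left, the optimal
  -- strategy accepts the last applicant of μ while holding j selections. These μ form G^{σ,i}
  -- and those with j = k form Γ^{σ,i}_k.
  mutual
    stops : ℕ → ℕ → List ℕ → List (List ℕ × ℕ)
    stops zero    _       _ = []
    stops (suc f) zero    _ = []
    stops (suc f) (suc i) σ = concatMap (λ τ → stopsAt f i τ (positive? (suc i) τ)) (ext σ)

    stopsAt : ℕ → ∀ i τ → Dec (TypePositive N (suc i) τ) → List (List ℕ × ℕ)
    stopsAt f i τ (yes _) = (τ , suc i) ∷ stops f i τ
    stopsAt f i τ (no  _) = stops f (suc i) τ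

  stopsFrom : ℕ → ℕ → List ℕ → List (List ℕ × ℕ)
  stopsFrom f i τ = stopsAt f i τ (positive? (suc i) τ)

  root : ∀ f i σ {x} → x ∈ stops (suc f) (suc i) σ → Σ[ τ ∈ List ℕ ] τ ∈ ext σ × x ∈ stopsFrom f i τ
  root f i σ x∈ = find (∈-concatMap⁻ (stopsFrom f i) {xs = ext σ} x∈)

  record ValidStop (σ : List ℕ) (i : ℕ) (μ : List ℕ) (j : ℕ) : Set where
    field
      isPerm   : IsPerm (length μ) μ
      prefix   : HasPrefix σ μ
      longer   : length σ < length μ
      tag≥1    : 1 ≤ j
      tag≤i    : j ≤ i
      positive : TypePositive N j μ

  open ValidStop

  ValidStop-ext : ∀ {σ τ i i′ μ j} → τ ∈ ext σ → i ≤ i′ → ValidStop τ i μ j → ValidStop σ i′ μ j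
  ValidStop-ext {σ} τ∈ i≤i′ v = record
    { isPerm   = isPerm v
    ; prefix   = HasPrefix-trans (ext-HasPrefix {σ} τ∈) (prefix v)
    ; longer   = ℕP.<-trans (ℕP.≤-reflexive (sym (ext-length {σ} τ∈))) (longer v)
    ; tag≥1    = tag≥1 v
    ; tag≤i    = ℕP.≤-trans (tag≤i v) i≤i′
    ; positive = positive v
    }

  mutual
    stops-valid : ∀ f i σ {μ j} → (μ , j) ∈ stops f i σ → ValidStop σ i μ j
    stops-valid (suc f) (suc i) σ x∈ =
      let τ , τ∈ , x∈τ = root f i σ x∈ in stopsAt-valid f i τ∈ (positive? (suc i) _) x∈τ

    stopsAt-valid : ∀ f i {σ τ} → τ ∈ ext σ → (d : Dec (TypePositive N (suc i) τ)) →
                    ∀ {μ j} → (μ , j) ∈ stopsAt f i τ d → ValidStop σ (suc i) μ j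
    stopsAt-valid f i {σ} τ∈ (yes p) (here refl) = record
      { isPerm   = ext-isPerm {σ} τ∈
      ; prefix   = ext-HasPrefix {σ} τ∈
      ; longer   = ℕP.≤-reflexive (sym (ext-length {σ} τ∈))
      ; tag≥1    = s≤s z≤n
      ; tag≤i    = ℕP.≤-refl
      ; positive = p
      }
    stopsAt-valid f i τ∈ (yes _) (there x∈) = ValidStop-ext τ∈ (ℕP.n≤1+n i) (stops-valid f i _ x∈)
    stopsAt-valid f i τ∈ (no  _) x∈         = ValidStop-ext τ∈ ℕP.≤-refl (stops-valid f (suc i) _ x∈)

  stopsAt-⊑ : ∀ f i τ d {μ j} → (μ , j) ∈ stopsAt f i τ d → τ ⊑ μ
  stopsAt-⊑ f i τ (yes _) (here refl) = inj₁ refl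
  stopsAt-⊑ f i τ (yes _) (there x∈)  = let v = stops-valid f i τ x∈ in inj₂ (longer v , proj₂ (prefix v))
  stopsAt-⊑ f i τ (no  _) x∈          = let v = stops-valid f (suc i) τ x∈ in inj₂ (longer v , proj₂ (prefix v))

  same-root : ∀ {σ τ τ′ μ} → τ ∈ ext σ → τ′ ∈ ext σ → τ ⊑ μ → τ′ ⊑ μ → τ ≡ τ′
  same-root {σ} τ∈ τ′∈ τ⊑μ τ′⊑μ = ⊑-unique τ⊑μ τ′⊑μ (trans (ext-length {σ} τ∈) (sym (ext-length {σ} τ′∈)))

  mutual
    stops-unique : ∀ f i σ → Unique (map proj₁ (stops f i σ))
    stops-unique zero    _       _ = []
    stops-unique (suc f) zero    _ = []
    stops-unique (suc f) (suc i) σ =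
      subst Unique (sym (LP.map-concatMap proj₁ (stopsFrom f i) (ext σ)))
        (Unique-concatMap (map proj₁ ∘ stopsFrom f i) (ext-unique σ)
          (λ {τ} _ → stopsAt-unique f i τ (positive? (suc i) τ)) disjoint)
      where
      disjoint : ∀ {τ τ′ μ} → τ ∈ ext σ → τ′ ∈ ext σ →
                 μ ∈ map proj₁ (stopsFrom f i τ) → μ ∈ map proj₁ (stopsFrom f i τ′) → τ ≡ τ′
      disjoint {τ} {τ′} τ∈ τ′∈ μ∈ μ∈′ with ∈-map⁻ proj₁ μ∈ | ∈-map⁻ proj₁ μ∈′
      ... | _ , x∈ , refl | _ , x∈′ , refl =
        same-root {σ} τ∈ τ′∈ (stopsAt-⊑ f i τ (positive? (suc i) τ) x∈) (stopsAt-⊑ f i τ′ (positive? (suc i) τ′) x∈′)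

    stopsAt-unique : ∀ f i τ d → Unique (map proj₁ (stopsAt f i τ d))
    stopsAt-unique f i τ (yes _) =
      AllP.map⁺ (All.tabulate (λ x∈ τ≡μ → ℕP.<-irrefl (cong length τ≡μ) (longer (stops-valid f i τ x∈))))
      ∷ stops-unique f i τ
    stopsAt-unique f i τ (no _) = stops-unique f (suc i) τ

  mutual
    stops-tags-increase : ∀ f i σ {μ j μ′ j′} → (μ , j) ∈ stops f i σ → (μ′ , j′) ∈ stops f i σ →
                          ProperPrefix μ′ μ → j < j′
    stops-tags-increase (suc f) (suc i) σ x∈ x′∈ μ′⊏μ with root f i σ x∈ | root f i σ x′∈
    ... | τ , τ∈ , x∈τ | τ′ , τ′∈ , x′∈τ′
      with same-root {σ} τ∈ τ′∈ (stopsAt-⊑ f i τ (positive? (suc i) τ) x∈τ)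
                                (⊑-⊏ (stopsAt-⊑ f i τ′ (positive? (suc i) τ′) x′∈τ′) μ′⊏μ)
    ... | refl = stopsAt-tags-increase f i τ (positive? (suc i) τ) x∈τ x′∈τ′ μ′⊏μ

    stopsAt-tags-increase : ∀ f i τ d {μ j μ′ j′} → (μ , j) ∈ stopsAt f i τ d → (μ′ , j′) ∈ stopsAt f i τ d →
                            ProperPrefix μ′ μ → j < j′
    stopsAt-tags-increase f i τ (yes _) (here refl) (here refl) (lt , _) = ⊥-elim (ℕP.<-irrefl refl lt)
    stopsAt-tags-increase f i τ (yes _) (here refl) (there x′∈) (lt , _) =
      ⊥-elim (ℕP.<-asym lt (longer (stops-valid f i τ x′∈)))
    stopsAt-tags-increase f i τ (yes _) (there x∈) (here refl) _ = s≤s (tag≤i (stops-valid f i τ x∈))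
    stopsAt-tags-increase f i τ (yes _) (there x∈) (there x′∈) μ′⊏μ = stops-tags-increase f i τ x∈ x′∈ μ′⊏μ
    stopsAt-tags-increase f i τ (no  _) x∈ x′∈ μ′⊏μ = stops-tags-increase f (suc i) τ x∈ x′∈ μ′⊏μ

  stops-minimal : ∀ f i σ → Minimal i (map proj₁ (stops f i σ))
  stops-minimal f i σ = Minimal-by-tags i (stops f i σ)
    (λ x∈ → let v = stops-valid f i σ x∈ in tag≥1 v , tag≤i v) (stops-tags-increase f i σ)

  level-stopsAt-yes : ∀ f i τ p → level (suc i) (stopsAt f i τ (yes p)) ≡ τ ∷ []
  level-stopsAt-yes f i τ p = trans (level-∷-≡ (stops f i τ))
    (cong (τ ∷_) (level-above (suc i) (stops f i τ) (λ x∈ → s≤s (tag≤i (stops-valid f i τ x∈)))))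

  -- QoF recurses on the fuel N ∸ length σ, tracked below as the invariant length σ + f ≡ N.
  fuel-< : ∀ {σ : List ℕ} {f} → length σ + suc f ≡ N → length σ < N
  fuel-< {σ} {f} e = subst (length σ <_) e (ℕP.m<m+n (length σ) (s≤s z≤n))

  fuel-ext : ∀ {σ τ f} → τ ∈ ext σ → length σ + suc f ≡ N → length τ + f ≡ N
  fuel-ext {σ} {τ} {f} τ∈ e = trans (cong (_+ f) (ext-length {σ} τ∈)) (trans (sym (ℕP.+-suc (length σ) f)) e)

  Qo≡QoF : ∀ {f} i τ → length τ + f ≡ N → Qo N i τ ≡ QoF f N i τ
  Qo≡QoF {f} i τ e = cong (λ k → QoF k N i τ) (trans (cong (_∸ length τ) (sym e)) (ℕP.m+n∸m≡n (length τ) f))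

  best : ℕ → ℕ → List ℕ → ℚ
  best f i τ = (Q1 N τ +ℚ QoF f N i τ) ⊔ QoF f N (suc i) τ

  best-positive : ∀ {f} i τ → length τ + f ≡ N → TypePositive N (suc i) τ →
                  best f i τ ≡ Q1 N τ +ℚ QoF f N i τ
  best-positive i τ e p =
    ℚP.p≥q⇒p⊔q≡p (subst₂ _≤ℚ_ (Qo≡QoF (suc i) τ e) (cong (Q1 N τ +ℚ_) (Qo≡QoF i τ e)) p)

  best-nonpositive : ∀ {f} i τ → length τ + f ≡ N → ¬ TypePositive N (suc i) τ →
                     best f i τ ≡ QoF f N (suc i) τ
  best-nonpositive i τ e ¬p = ℚP.p≤q⇒p⊔q≡q (ℚP.<⇒≤ (ℚP.≰⇒> (¬p ∘
    subst₂ _≤ℚ_ (sym (Qo≡QoF (suc i) τ e)) (cong (Q1 N τ +ℚ_) (sym (Qo≡QoF i τ e))))))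

  full-length-positive : ∀ i τ → length τ + 0 ≡ N → TypePositive N (suc i) τ
  full-length-positive i τ e = subst₂ _≤ℚ_ (sym (Qo≡QoF (suc i) τ e))
    (sym (trans (cong (Q1 N τ +ℚ_) (Qo≡QoF i τ e)) (ℚP.+-identityʳ (Q1 N τ)))) (0≤frac (Win N τ) (SD N τ))

  QoF-suc-*-SDq : ∀ f i σ → length σ < N →
    QoF (suc f) N (suc i) σ *ℚ SDq N σ ≡ sumℚ (map (λ τ → best f i τ *ℚ SDq N τ) (ext σ))
  QoF-suc-*-SDq f i σ ℓ<N =
    trans (sumℚ-map-*ʳ (λ τ → frac (SD N τ) (SD N σ) *ℚ best f i τ) (SDq N σ) (ext σ))
          (sumℚ-map-cong (ext σ) reweigh)
    where
    reweigh : ∀ {τ} → τ ∈ ext σ → (frac (SD N τ) (SD N σ) *ℚ best f i τ) *ℚ SDq N σ ≡ best f i τ *ℚ SDq N τ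
    reweigh {τ} τ∈ = begin
      (frac (SD N τ) (SD N σ) *ℚ best f i τ) *ℚ SDq N σ ≡⟨ cong (_*ℚ SDq N σ) (ℚP.*-comm _ (best f i τ)) ⟩
      (best f i τ *ℚ frac (SD N τ) (SD N σ)) *ℚ SDq N σ ≡⟨ ℚP.*-assoc (best f i τ) _ _ ⟩
      best f i τ *ℚ (frac (SD N τ) (SD N σ) *ℚ SDq N σ) ≡⟨ cong (best f i τ *ℚ_) (frac-*-denominator _ _ SDσ≡0⇒SDτ≡0) ⟩
      best f i τ *ℚ SDq N τ                              ∎
      where
      open ≡-Reasoning
      SDσ≡0⇒SDτ≡0 : SD N σ ≡ 0 → SD N τ ≡ 0
      SDσ≡0⇒SDτ≡0 SDσ≡0 = ℕP.n≤0⇒n≡0 (subst (SD N τ ≤_) SDσ≡0 (SD-ext-≤ N ℓ<N τ∈))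

  stops-Q1·SD : ∀ f i σ → length σ + f ≡ N →
    QoF f N i σ *ℚ SDq N σ ≡ sumℚ (map (Q1·SD N ∘ proj₁) (stops f i σ))
  stops-Q1·SD zero    i       σ _ = ℚP.*-zeroˡ (SDq N σ)
  stops-Q1·SD (suc f) zero    σ _ = ℚP.*-zeroˡ (SDq N σ)
  stops-Q1·SD (suc f) (suc i) σ e = begin
    QoF (suc f) N (suc i) σ *ℚ SDq N σ
      ≡⟨ QoF-suc-*-SDq f i σ (fuel-< {σ} e) ⟩
    sumℚ (map (λ τ → best f i τ *ℚ SDq N τ) (ext σ))
      ≡⟨ sumℚ-map-cong (ext σ) (λ {τ} τ∈ → branch τ (fuel-ext {σ} τ∈ e) (positive? (suc i) τ)) ⟩
    sumℚ (map (λ τ → sumℚ (map (Q1·SD N ∘ proj₁) (stopsFrom f i τ))) (ext σ))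
      ≡⟨ sumℚ-map-concatMap (Q1·SD N ∘ proj₁) (stopsFrom f i) (ext σ) ⟨
    sumℚ (map (Q1·SD N ∘ proj₁) (stops (suc f) (suc i) σ)) ∎
    where
    open ≡-Reasoning
    branch : ∀ τ → length τ + f ≡ N → (d : Dec (TypePositive N (suc i) τ)) →
             best f i τ *ℚ SDq N τ ≡ sumℚ (map (Q1·SD N ∘ proj₁) (stopsAt f i τ d))
    branch τ eτ (yes p) = begin
      best f i τ *ℚ SDq N τ                    ≡⟨ cong (_*ℚ SDq N τ) (best-positive i τ eτ p) ⟩
      (Q1 N τ +ℚ QoF f N i τ) *ℚ SDq N τ        ≡⟨ ℚP.*-distribʳ-+ (SDq N τ) (Q1 N τ) _ ⟩
      Q1·SD N τ +ℚ QoF f N i τ *ℚ SDq N τ       ≡⟨ cong (Q1·SD N τ +ℚ_) (stops-Q1·SD f i τ eτ) ⟩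
      Q1·SD N τ +ℚ sumℚ (map (Q1·SD N ∘ proj₁) (stops f i τ)) ∎
    branch τ eτ (no ¬p) =
      trans (cong (_*ℚ SDq N τ) (best-nonpositive i τ eτ ¬p)) (stops-Q1·SD f (suc i) τ eτ)

  stops-top-Q·SD : ∀ f i σ → length σ + suc f ≡ N →
    QoF (suc f) N (suc i) σ *ℚ SDq N σ ≡ sumℚ (map (Q·SD N (suc i)) (level (suc i) (stops (suc f) (suc i) σ)))
  stops-top-Q·SD f i σ e = begin
    QoF (suc f) N (suc i) σ *ℚ SDq N σ
      ≡⟨ QoF-suc-*-SDq f i σ (fuel-< {σ} e) ⟩
    sumℚ (map (λ τ → best f i τ *ℚ SDq N τ) (ext σ))
      ≡⟨ sumℚ-map-cong (ext σ) (λ {τ} τ∈ → branch f τ (fuel-ext {σ} τ∈ e) (positive? (suc i) τ)) ⟩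
    sumℚ (map (λ τ → sumℚ (map (Q·SD N (suc i)) (level (suc i) (stopsFrom f i τ)))) (ext σ))
      ≡⟨ sumℚ-map-concatMap (Q·SD N (suc i)) (level (suc i) ∘ stopsFrom f i) (ext σ) ⟨
    sumℚ (map (Q·SD N (suc i)) (concatMap (level (suc i) ∘ stopsFrom f i) (ext σ)))
      ≡⟨ cong (sumℚ ∘ map (Q·SD N (suc i))) (level-concatMap (suc i) (stopsFrom f i) (ext σ)) ⟨
    sumℚ (map (Q·SD N (suc i)) (level (suc i) (stops (suc f) (suc i) σ))) ∎
    where
    open ≡-Reasoning
    branch : ∀ g τ → length τ + g ≡ N → (d : Dec (TypePositive N (suc i) τ)) →
             best g i τ *ℚ SDq N τ ≡ sumℚ (map (Q·SD N (suc i)) (level (suc i) (stopsAt g i τ d)))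
    branch g τ eτ (yes p) = begin
      best g i τ *ℚ SDq N τ
        ≡⟨ cong (_*ℚ SDq N τ) (trans (best-positive i τ eτ p) (cong (Q1 N τ +ℚ_) (sym (Qo≡QoF i τ eτ)))) ⟩
      Q·SD N (suc i) τ
        ≡⟨ ℚP.+-identityʳ _ ⟨
      Q·SD N (suc i) τ +ℚ 0ℚ
        ≡⟨ cong (sumℚ ∘ map (Q·SD N (suc i))) (level-stopsAt-yes g i τ p) ⟨
      sumℚ (map (Q·SD N (suc i)) (level (suc i) (stopsAt g i τ (yes p)))) ∎
    branch zero    τ eτ (no ¬p) = ⊥-elim (¬p (full-length-positive i τ eτ))
    branch (suc g) τ eτ (no ¬p) =
      trans (cong (_*ℚ SDq N τ) (best-nonpositive i τ eτ ¬p)) (stops-top-Q·SD g i τ eτ)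

  stops-top-SD : ∀ f i σ → length σ + suc f ≡ N →
    SD N σ ≡ sum (map (SD N) (level (suc i) (stops (suc f) (suc i) σ)))
  stops-top-SD f i σ e = begin
    SD N σ
      ≡⟨ SD-ext N σ (fuel-< {σ} e) ⟩
    sum (map (SD N) (ext σ))
      ≡⟨ sum-map-cong (ext σ) (λ {τ} τ∈ → branch f τ (fuel-ext {σ} τ∈ e) (positive? (suc i) τ)) ⟩
    sum (map (λ τ → sum (map (SD N) (level (suc i) (stopsFrom f i τ)))) (ext σ))
      ≡⟨ sum-map-concatMap (SD N) (level (suc i) ∘ stopsFrom f i) (ext σ) ⟨
    sum (map (SD N) (concatMap (level (suc i) ∘ stopsFrom f i) (ext σ)))
      ≡⟨ cong (sum ∘ map (SD N)) (level-concatMap (suc i) (stopsFrom f i) (ext σ)) ⟨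
    sum (map (SD N) (level (suc i) (stops (suc f) (suc i) σ))) ∎
    where
    open ≡-Reasoning
    branch : ∀ g τ → length τ + g ≡ N → (d : Dec (TypePositive N (suc i) τ)) →
             SD N τ ≡ sum (map (SD N) (level (suc i) (stopsAt g i τ d)))
    branch g τ _ (yes p) =
      sym (trans (cong (sum ∘ map (SD N)) (level-stopsAt-yes g i τ p)) (ℕP.+-identityʳ (SD N τ)))
    branch zero    τ eτ (no ¬p) = ⊥-elim (¬p (full-length-positive i τ eτ))
    branch (suc g) τ eτ (no _)  = stops-top-SD g i τ eτ

  stops-Coll : ∀ f i σ → length σ + suc f ≡ N → Coll N σ (suc i) (map proj₁ (stops (suc f) (suc i) σ))
  stops-Coll f i σ e =
    Γ , stops-unique (suc f) (suc i) σ , levels-partition (suc i) L tags , members ,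
    stops-minimal (suc f) (suc i) σ , Γ-positive , top-Q·SD , Q1·SD-sum , top-SD
    where
    L = stops (suc f) (suc i) σ

    Γ : Fin (suc i) → List (List ℕ)
    Γ j = level (suc (toℕ j)) L

    valid : ∀ {μ j} → (μ , j) ∈ L → ValidStop σ (suc i) μ j
    valid = stops-valid (suc f) (suc i) σ

    tags : ∀ {x} → x ∈ L → 1 ≤ proj₂ x × proj₂ x ≤ suc i
    tags x∈ = tag≥1 (valid x∈) , tag≤i (valid x∈)

    members : All (λ μ → IsPerm (length μ) μ × HasPrefix σ μ × length σ < length μ) (map proj₁ L)
    members = AllP.map⁺ (All.tabulate (λ x∈ → isPerm (valid x∈) , prefix (valid x∈) , longer (valid x∈)))

    Γ-positive : ∀ j → All (TypePositive N (suc (toℕ j))) (Γ j)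
    Γ-positive j = All.tabulate (λ μ∈ → positive (valid (∈-level⁻ L μ∈)))

    Γ-top : Γ (fromℕ i) ≡ level (suc i) L
    Γ-top = cong (λ k → level (suc k) L) (FinP.toℕ-fromℕ i)

    Qo≡ : Qo N (suc i) σ ≡ QoF (suc f) N (suc i) σ
    Qo≡ = Qo≡QoF (suc i) σ e

    top-Q·SD : Qo N (suc i) σ *ℚ SDq N σ ≡ sumℚ (map (Q·SD N (suc i)) (Γ (fromℕ i)))
    top-Q·SD = trans (cong (_*ℚ SDq N σ) Qo≡)
      (trans (stops-top-Q·SD f i σ e) (cong (sumℚ ∘ map (Q·SD N (suc i))) (sym Γ-top)))

    Q1·SD-sum : Qo N (suc i) σ *ℚ SDq N σ ≡ sumℚ (map (Q1·SD N) (map proj₁ L))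
    Q1·SD-sum = trans (cong (_*ℚ SDq N σ) Qo≡) (trans (stops-Q1·SD (suc f) (suc i) σ e) (cong sumℚ (LP.map-∘ L)))

    top-SD : SD N σ ≡ sum (map (SD N) (Γ (fromℕ i)))
    top-SD = trans (stops-top-SD f i σ e) (cong (sum ∘ map (SD N)) (sym Γ-top))

  Coll-exists : ∀ i σ → length σ < N → Σ[ G ∈ List (List ℕ) ] Coll N σ (suc i) G
  Coll-exists i σ ℓ<N = map proj₁ (stops (suc f) (suc i) σ) , stops-Coll f i σ fuel
    where
    f : ℕ
    f = N ∸ suc (length σ)
    fuel : length σ + suc f ≡ N
    fuel = trans (ℕP.+-suc (length σ) f) (ℕP.m+[n∸m]≡n ℓ<N)

QoF-no-selections : ∀ f N σ → QoF f N 0 σ ≡ 0ℚ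
QoF-no-selections zero    N σ = refl
QoF-no-selections (suc f) N σ = refl

Coll-Qo·SD : ∀ N k σ {G} → Coll N σ k G → Qo N k σ *ℚ SDq N σ ≡ sumℚ (map (Q1·SD N) G)
Coll-Qo·SD N zero    σ refl =
  trans (cong (_*ℚ SDq N σ) (QoF-no-selections (N ∸ length σ) N σ)) (ℚP.*-zeroˡ (SDq N σ))
Coll-Qo·SD N (suc k) σ (_ , _ , _ , _ , _ , _ , _ , Q1·SD-sum , _) = Q1·SD-sum

Coll-Q·SD : ∀ N k σ {G} → Coll N σ k G → Q·SD N (suc k) σ ≡ Q1·SD N σ +ℚ sumℚ (map (Q1·SD N) G)
Coll-Q·SD N k σ c =
  trans (ℚP.*-distribʳ-+ (SDq N σ) (Q1 N σ) (Qo N k σ)) (cong (Q1·SD N σ +ℚ_) (Coll-Qo·SD N k σ c))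

mainTheorem3 : (N s i : ℕ) (σ : List ℕ) → 1 ≤ N → 1 ≤ s → 1 ≤ i → i ≤ s →
    IsPerm (length σ) σ → length σ + 1 + i ≤ N →
    (Σ[ G ∈ List (List ℕ) ] Coll N σ i G)
    × ((G′ : List (List ℕ)) → Coll N σ (i ∸ 1) G′ →
         Q N i σ *ℚ SDq N σ
           ≡ Q1 N σ *ℚ SDq N σ +ℚ sumℚ (map (λ μ → Q1 N μ *ℚ SDq N μ) G′))
mainTheorem3 N _ (suc i) σ _ _ _ _ _ bound = StoppingRule.Coll-exists N i σ ℓ<N , λ _ → Coll-Q·SD N i σ
  where
  ℓ<N : length σ < N
  ℓ<N = subst (_≤ N) (ℕP.+-comm (length σ) 1) (ℕP.m+n≤o⇒m≤o (length σ + 1) bound)
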